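{- Let $\vec{w}=(w_1,\ldots,w_d)$ be a vector of positive integers with $\max_i w_i\le 2$. Then $|R(\vec{w})|=\min_i w_i$.
   Context: For a vector of positive integers $\vec{w}=(w_1,\ldots,w_d)$, let $\mathcal{P}_{\vec{w}}$ be the set of integer vectors $(x_1,\ldots,x_d)$ with $1\le x_i\le w_i$ for all $i$, strictly partially ordered by $\vec{y}<\vec{x}$ iff $y_i<x_i$ for every $i$. An antichain is a subset in which no two elements are comparable; it is maximal if it is not a proper subset of another antichain. $R(\vec{w})$ denotes the set of maximal antichains of $\mathcal{P}_{\vec{w}}$. -}

module Defs where

open import Data.Nat using (ℕ; suc; _≤_; _<_; _⊓_)
open import Data.Fin using (Fin)
open import Data.Vec using (Vec; lookup; foldr₁)
open import Data.Bool using (Bool; true)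
open import Data.Product using (Σ; ∃; _×_)
open import Relation.Binary.PropositionalEquality using (_≡_)
open import Relation.Nullary using (¬_)

Point : ℕ → Set
Point d = Vec ℕ d

InBox : ∀ {d} → Vec ℕ d → Point d → Set
InBox w x = ∀ i → 1 ≤ lookup x i × lookup x i ≤ lookup w i

_≺_ : ∀ {d} → Point d → Point d → Set
y ≺ x = ∀ i → lookup y i < lookup x i

Family : ℕ → Set
Family d = Point d → Bool

_∈F_ : ∀ {d} → Point d → Family d → Set
x ∈F A = A x ≡ true

_⊆F_ : ∀ {d} → Family d → Family d → Set
A ⊆F B = ∀ x → x ∈F A → x ∈F B

_≐F_ : ∀ {d} → Family d → Family d → Set
A ≐F B = A ⊆F B × B ⊆F A

IsSubsetOf : ∀ {d} → Vec ℕ d → Family d → Set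
IsSubsetOf w A = ∀ x → x ∈F A → InBox w x

IsAntichain : ∀ {d} → Vec ℕ d → Family d → Set
IsAntichain w A = IsSubsetOf w A × (∀ x y → x ∈F A → y ∈F A → ¬ (x ≺ y))

IsMaximalAntichain : ∀ {d} → Vec ℕ d → Family d → Set
IsMaximalAntichain w A =
  IsAntichain w A × (∀ B → IsAntichain w B → A ⊆F B → B ⊆F A)

-- The collection of sets satisfying P has exactly m elements (up to set equality):
-- an explicit enumeration A_0..A_{m-1}, all in the collection, covering it, pairwise distinct.
HasCardinality : ∀ {d} → (Family d → Set) → ℕ → Set
HasCardinality {d} P m =
  Σ (Vec (Family d) m) λ As →
    (∀ j → P (lookup As j)) ×
    (∀ A → P A → ∃ λ j → A ≐F lookup As j) ×
    (∀ j k → lookup As j ≐F lookup As k → j ≡ k)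

minV : ∀ {d} → Vec ℕ (suc d) → ℕ
minV = foldr₁ _⊓_

-- A box with some w_i = 1 has no comparable pair, so the whole box is its unique
-- maximal antichain.  If every w_i = 2 the box is the cube {1,2}^d, whose only
-- comparable pair is 1̄ ≺ 2̄; a maximal antichain must omit exactly one of the two,
-- giving the two maximal antichains box ∖ 2̄ and box ∖ 1̄.
module Submission where

open import Defs
open import Data.Nat using (ℕ; zero; suc; _≤_; s≤s; z≤n; _≟_; _≤?_)
open import Data.Nat.Properties using (≤-refl; ≤-trans; ≤-antisym; <-irrefl; m⊓n≤m; m⊓n≤n; ⊓-sel)
open import Data.Vec using (Vec; lookup; []; _∷_; replicate)
open import Data.Vec.Properties using (≡-dec; lookup-replicate; tabulate∘lookup; tabulate-cong)
open import Data.Fin using (zero; suc)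
open import Data.Fin.Properties using (all?; any?)
open import Data.Product using (_×_; _,_; proj₁; proj₂; ∃)
open import Data.Sum using (_⊎_; inj₁; inj₂; [_,_]′)
open import Data.Bool using (true; false; _∧_; not)
open import Data.Empty using (⊥-elim)
open import Relation.Nullary using (¬_; Dec; yes; no; contradiction)
open import Relation.Nullary.Decidable using (⌊_⌋; _×-dec_)
open import Relation.Binary.PropositionalEquality
  using (_≡_; refl; sym; trans; subst)

minV-≤ : ∀ {d} (w : Vec ℕ (suc d)) i → minV w ≤ lookup w i
minV-≤ (x ∷ [])     zero    = ≤-refl
minV-≤ (x ∷ y ∷ ys) zero    = m⊓n≤m x _
minV-≤ (x ∷ y ∷ ys) (suc i) = ≤-trans (m⊓n≤n x _) (minV-≤ (y ∷ ys) i)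

minV-attained : ∀ {d} (w : Vec ℕ (suc d)) → ∃ λ i → minV w ≡ lookup w i
minV-attained (x ∷ []) = zero , refl
minV-attained (x ∷ y ∷ ys) with ⊓-sel x (minV (y ∷ ys))
... | inj₁ e = zero , e
... | inj₂ e with minV-attained (y ∷ ys)
...   | i , e′ = suc i , trans e e′

lookup-injective : ∀ {n} {x y : Point n} → (∀ i → lookup x i ≡ lookup y i) → x ≡ y
lookup-injective {x = x} {y} eq =
  trans (sym (tabulate∘lookup x)) (trans (tabulate-cong eq) (tabulate∘lookup y))

≺-irrefl : ∀ {d} (x : Point (suc d)) → ¬ x ≺ x
≺-irrefl x x≺x = <-irrefl refl (x≺x zero)

∉-if-false : ∀ {n} (A : Family n) {x} → A x ≡ false → ¬ x ∈F A
∉-if-false A Ax≡false x∈A = contradiction (trans (sym Ax≡false) x∈A) λ ()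

inBox? : ∀ {n} (w : Vec ℕ n) (x : Point n) → Dec (InBox w x)
inBox? w x = all? λ i → (1 ≤? lookup x i) ×-dec (lookup x i ≤? lookup w i)

box : ∀ {n} → Vec ℕ n → Family n
box w x = ⌊ inBox? w x ⌋

∈-box⁺ : ∀ {n} (w : Vec ℕ n) x → InBox w x → x ∈F box w
∈-box⁺ w x x∈ with inBox? w x
... | yes _ = refl
... | no x∉ = contradiction x∈ x∉

∈-box⁻ : ∀ {n} (w : Vec ℕ n) x → x ∈F box w → InBox w x
∈-box⁻ w x x∈ with inBox? w x
... | yes x∈′ = x∈′

infixl 25 _∖_

_∖_ : ∀ {n} → Family n → Point n → Family n
(A ∖ p) x = A x ∧ not ⌊ ≡-dec _≟_ x p ⌋

∈-∖⁺ : ∀ {n} (A : Family n) {p} x → x ∈F A → ¬ x ≡ p → x ∈F A ∖ p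
∈-∖⁺ A {p} x x∈A x≢p with ≡-dec _≟_ x p
... | yes x≡p = contradiction x≡p x≢p
... | no _ rewrite x∈A = refl

∈-∖⁻ : ∀ {n} (A : Family n) p x → x ∈F A ∖ p → x ∈F A × ¬ x ≡ p
∈-∖⁻ A p x x∈ with A x | ≡-dec _≟_ x p
... | true | no x≢p = refl , x≢p

∉-∖⇒≡ : ∀ {n} (A : Family n) p x → x ∈F A → ¬ x ∈F A ∖ p → x ≡ p
∉-∖⇒≡ A p x x∈A x∉ = decide (≡-dec _≟_ x p)
  where
  decide : Dec (x ≡ p) → x ≡ p
  decide (yes x≡p) = x≡p
  decide (no x≢p)  = contradiction (∈-∖⁺ A x x∈A x≢p) x∉

⊆-box∖ : ∀ {n} (w : Vec ℕ n) {A p} → IsSubsetOf w A → ¬ p ∈F A → A ⊆F box w ∖ p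
⊆-box∖ w A⊆P p∉A x x∈A = ∈-∖⁺ (box w) x (∈-box⁺ w x (A⊆P x x∈A)) λ { refl → p∉A x∈A }

maximal-if-dominating : ∀ {n} (w : Vec ℕ n) {A} → IsAntichain w A →
  (∀ x → InBox w x → ¬ x ∈F A → ∃ λ y → y ∈F A × (x ≺ y ⊎ y ≺ x)) →
  IsMaximalAntichain w A
maximal-if-dominating w {A} A-anti dominating = A-anti , absorbs
  where
  absorbs : ∀ B → IsAntichain w B → A ⊆F B → B ⊆F A
  absorbs B (B⊆P , B-anti) A⊆B x x∈B with A x in eq
  ... | true  = refl
  ... | false with dominating x (B⊆P x x∈B) (∉-if-false A eq)
  ...   | y , y∈A , inj₁ x≺y = ⊥-elim (B-anti x y x∈B (A⊆B y y∈A) x≺y)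
  ...   | y , y∈A , inj₂ y≺x = ⊥-elim (B-anti y x (A⊆B y y∈A) x∈B y≺x)

maximal-⊆-antichain⇒≐ : ∀ {n} (w : Vec ℕ n) {A B} →
  IsMaximalAntichain w A → IsAntichain w B → A ⊆F B → A ≐F B
maximal-⊆-antichain⇒≐ w (_ , maximal) B-anti A⊆B = A⊆B , maximal _ B-anti A⊆B

module WithoutComparablePairs {n} (w : Vec ℕ n)
  (incomparable : ∀ x y → InBox w x → InBox w y → ¬ x ≺ y) where

  box-antichain : IsAntichain w (box w)
  box-antichain = ∈-box⁻ w , λ x y x∈ y∈ →
    incomparable x y (∈-box⁻ w x x∈) (∈-box⁻ w y y∈)

  box-maximal : IsMaximalAntichain w (box w)
  box-maximal = maximal-if-dominating w box-antichain λ x x∈P x∉ →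
    contradiction (∈-box⁺ w x x∈P) x∉

  maximalAntichains-card : HasCardinality (IsMaximalAntichain w) 1
  maximalAntichains-card =
    box w ∷ [] ,
    (λ { zero → box-maximal }) ,
    (λ A A-max → zero , maximal-⊆-antichain⇒≐ w A-max box-antichain
                          (λ x x∈A → ∈-box⁺ w x (proj₁ (proj₁ A-max) x x∈A))) ,
    λ { zero zero _ → refl }

module WithOneComparablePair {d} (w : Vec ℕ (suc d)) (p q : Point (suc d))
  (p∈P : InBox w p) (q∈P : InBox w q) (p≺q : p ≺ q)
  (onlyPair : ∀ x y → InBox w x → InBox w y → x ≺ y → x ≡ p × y ≡ q) where

  p≢q : ¬ p ≡ q
  p≢q refl = ≺-irrefl p p≺q

  box∖q-antichain : IsAntichain w (box w ∖ q)
  box∖q-antichain =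
    (λ x x∈ → ∈-box⁻ w x (proj₁ (∈-∖⁻ (box w) q x x∈))) ,
    λ x y x∈ y∈ x≺y →
      let (x∈P , _) = ∈-∖⁻ (box w) q x x∈ ; (y∈P , y≢q) = ∈-∖⁻ (box w) q y y∈ in
      y≢q (proj₂ (onlyPair x y (∈-box⁻ w x x∈P) (∈-box⁻ w y y∈P) x≺y))

  box∖p-antichain : IsAntichain w (box w ∖ p)
  box∖p-antichain =
    (λ x x∈ → ∈-box⁻ w x (proj₁ (∈-∖⁻ (box w) p x x∈))) ,
    λ x y x∈ y∈ x≺y →
      let (x∈P , x≢p) = ∈-∖⁻ (box w) p x x∈ ; (y∈P , _) = ∈-∖⁻ (box w) p y y∈ in
      x≢p (proj₁ (onlyPair x y (∈-box⁻ w x x∈P) (∈-box⁻ w y y∈P) x≺y))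

  p∈box∖q : p ∈F box w ∖ q
  p∈box∖q = ∈-∖⁺ (box w) p (∈-box⁺ w p p∈P) p≢q

  q∈box∖p : q ∈F box w ∖ p
  q∈box∖p = ∈-∖⁺ (box w) q (∈-box⁺ w q q∈P) (λ q≡p → p≢q (sym q≡p))

  box∖q-maximal : IsMaximalAntichain w (box w ∖ q)
  box∖q-maximal = maximal-if-dominating w box∖q-antichain λ x x∈P x∉ →
    p , p∈box∖q , inj₂ (subst (p ≺_) (sym (∉-∖⇒≡ (box w) q x (∈-box⁺ w x x∈P) x∉)) p≺q)

  box∖p-maximal : IsMaximalAntichain w (box w ∖ p)
  box∖p-maximal = maximal-if-dominating w box∖p-antichain λ x x∈P x∉ →
    q , q∈box∖p , inj₁ (subst (_≺ q) (sym (∉-∖⇒≡ (box w) p x (∈-box⁺ w x x∈P) x∉)) p≺q)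

  -- A maximal antichain cannot contain both p and q.
  maximal-cases : ∀ A → IsMaximalAntichain w A →
    A ≐F box w ∖ q ⊎ A ≐F box w ∖ p
  maximal-cases A A-max@((A⊆P , A-anti) , _) with A q in eq
  ... | false = inj₁ (maximal-⊆-antichain⇒≐ w A-max box∖q-antichain
                      (⊆-box∖ w A⊆P (∉-if-false A eq)))
  ... | true  = inj₂ (maximal-⊆-antichain⇒≐ w A-max box∖p-antichain
                      (⊆-box∖ w A⊆P λ p∈A → A-anti p q p∈A eq p≺q))

  box∖q≢box∖p : ¬ box w ∖ q ≐F box w ∖ p
  box∖q≢box∖p (⊆ , _) = proj₂ (∈-∖⁻ (box w) p p (⊆ p p∈box∖q)) refl

  maximalAntichains-card : HasCardinality (IsMaximalAntichain w) 2
  maximalAntichains-card =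
    box w ∖ q ∷ box w ∖ p ∷ [] ,
    (λ { zero → box∖q-maximal ; (suc zero) → box∖p-maximal }) ,
    (λ A A-max → [ (λ ≐ → zero , ≐) , (λ ≐ → suc zero , ≐) ]′ (maximal-cases A A-max)) ,
    λ { zero zero _ → refl ; (suc zero) (suc zero) _ → refl
      ; zero (suc zero) ≐ → contradiction ≐ box∖q≢box∖p
      ; (suc zero) zero (⊆ , ⊇) → contradiction (⊇ , ⊆) box∖q≢box∖p }

incomparable-if-thin : ∀ {n} (w : Vec ℕ n) i → lookup w i ≡ 1 →
  ∀ x y → InBox w x → InBox w y → ¬ x ≺ y
incomparable-if-thin w i wᵢ≡1 x y x∈P y∈P x≺y =
  <-irrefl refl (≤-trans (x≺y i) (≤-trans (subst (lookup y i ≤_) wᵢ≡1 (proj₂ (y∈P i)))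
                                          (proj₁ (x∈P i))))

module Cube {n} (w : Vec ℕ n) (all-two : ∀ i → lookup w i ≡ 2) where

  ones twos : Point n
  ones = replicate n 1
  twos = replicate n 2

  ones∈P : InBox w ones
  ones∈P i rewrite lookup-replicate i 1 | all-two i = s≤s z≤n , s≤s z≤n

  twos∈P : InBox w twos
  twos∈P i rewrite lookup-replicate i 2 | all-two i = s≤s z≤n , ≤-refl

  ones≺twos : ones ≺ twos
  ones≺twos i rewrite lookup-replicate i 1 | lookup-replicate i 2 = ≤-refl

  onlyPair : ∀ x y → InBox w x → InBox w y → x ≺ y → x ≡ ones × y ≡ twos
  onlyPair x y x∈P y∈P x≺y =
    lookup-injective (λ i → trans (xᵢ≡1 i) (sym (lookup-replicate i 1))) ,
    lookup-injective (λ i → trans (yᵢ≡2 i) (sym (lookup-replicate i 2)))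
    where
    yᵢ≤2 : ∀ i → lookup y i ≤ 2
    yᵢ≤2 i = subst (lookup y i ≤_) (all-two i) (proj₂ (y∈P i))
    xᵢ≡1 : ∀ i → lookup x i ≡ 1
    xᵢ≡1 i with ≤-trans (x≺y i) (yᵢ≤2 i)
    ... | s≤s xᵢ≤1 = ≤-antisym xᵢ≤1 (proj₁ (x∈P i))
    yᵢ≡2 : ∀ i → lookup y i ≡ 2
    yᵢ≡2 i = ≤-antisym (yᵢ≤2 i) (≤-trans (s≤s (proj₁ (x∈P i))) (x≺y i))

one-or-two : ∀ {v} → 1 ≤ v × v ≤ 2 → ¬ v ≡ 1 → v ≡ 2
one-or-two {1}       _              v≢1 = contradiction refl v≢1
one-or-two {2}       _              _   = refl
one-or-two {suc (suc (suc _))} (_ , s≤s (s≤s ())) _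

mainTheorem3 : (d : ℕ) (w : Vec ℕ (suc d)) →
    (∀ i → 1 ≤ lookup w i × lookup w i ≤ 2) →
    HasCardinality (IsMaximalAntichain w) (minV w)
mainTheorem3 d w bounds with minV-attained w | any? (λ i → lookup w i ≟ 1)
... | j , min≡wⱼ | yes (i , wᵢ≡1) =
  subst (HasCardinality (IsMaximalAntichain w)) (sym min≡1)
    (WithoutComparablePairs.maximalAntichains-card w (incomparable-if-thin w i wᵢ≡1))
  where
  min≡1 : minV w ≡ 1
  min≡1 = ≤-antisym (subst (minV w ≤_) wᵢ≡1 (minV-≤ w i))
                    (subst (1 ≤_) (sym min≡wⱼ) (proj₁ (bounds j)))
... | j , min≡wⱼ | no ∄wᵢ≡1 =
  subst (HasCardinality (IsMaximalAntichain w)) (sym (trans min≡wⱼ (all-two j)))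
    (WithOneComparablePair.maximalAntichains-card w ones twos ones∈P twos∈P ones≺twos onlyPair)
  where
  all-two : ∀ i → lookup w i ≡ 2
  all-two i = one-or-two (bounds i) (λ wᵢ≡1 → ∄wᵢ≡1 (i , wᵢ≡1))
  open Cube w all-two
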